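{- Let $H$ be a connected $4$-uniform hypergraph of order $8$ and diameter $2$. Then $W(H)\le 41$, and equality can only hold if $H$ has exactly $3$ hyperedges.
   Context: A hypergraph $H=(V,E)$ consists of a finite vertex set $V$ and a set $E$ of distinct subsets of $V$ (hyperedges); it is $4$-uniform if every hyperedge has exactly $4$ elements; its order is $|V|$. For $u,w\in V$, $d_H(u,w)$ is the least $\ell\ge0$ such that there are vertices $u=x_0,\dots,x_\ell=w$ with $x_{i-1},x_i$ in a common hyperedge for each $i$ ($\infty$ if none); $H$ is connected if all distances are finite; its diameter is $\max_{u,w}d_H(u,w)$. The Wiener index is $W(H)=\sum_{\{u,w\}\subseteq V,\,u\ne w} d_H(u,w)$. -}

module Defs where

open import Data.Nat using (ℕ; zero; suc; _+_; _⊔_; _<?_)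
open import Data.Bool using (Bool; true; false; _∧_; _∨_; if_then_else_)
open import Data.Bool.ListAction using (any)
open import Data.Fin using (Fin; toℕ; _≟_)
open import Data.Fin.Subset using (Subset; ∣_∣)
open import Data.Vec using (lookup)
open import Data.List using (List; []; _∷_; allFin; map; foldr; length; concatMap; filter; cartesianProduct)
open import Data.List.Relation.Unary.All using (All)
open import Data.List.Relation.Unary.Unique.Propositional using (Unique)
open import Data.Maybe using (Maybe; just; nothing)
open import Data.Product using (_×_; _,_; proj₁; proj₂; ∃-syntax)
open import Relation.Binary.PropositionalEquality using (_≡_)
open import Relation.Nullary.Decidable using (⌊_⌋)

record Hypergraph (n : ℕ) : Set where
  field
    edges    : List (Subset n)
    distinct : Unique edges

open Hypergraph public

Uniform4 : ∀ {n} → Hypergraph n → Set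
Uniform4 H = All (λ e → ∣ e ∣ ≡ 4) (edges H)

adj : ∀ {n} → Hypergraph n → Fin n → Fin n → Bool
adj H x y = any (λ e → lookup e x ∧ lookup e y) (edges H)

walk : ∀ {n} → Hypergraph n → ℕ → Fin n → Fin n → Bool
walk H zero    u w = ⌊ u ≟ w ⌋
walk H (suc ℓ) u w = any (λ x → adj H u x ∧ walk H ℓ x w) (allFin _)

search : ∀ {n} → Hypergraph n → Fin n → Fin n → ℕ → ℕ → Maybe ℕ
search H u w ℓ zero    = if walk H ℓ u w then just ℓ else nothing
search H u w ℓ (suc k) = if walk H ℓ u w then just ℓ else search H u w (suc ℓ) k

-- d_H(u,w): least ℓ ≥ 0 such that a walk of length ℓ exists; nothing = ∞.
-- (If u,w are connected, a shortest such sequence has length ≤ n - 1,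
--  so searching ℓ ∈ {0,…,n} is exhaustive.)
dist : ∀ {n} → Hypergraph n → Fin n → Fin n → Maybe ℕ
dist {n} H u w = search H u w 0 n

Connected : ∀ {n} → Hypergraph n → Set
Connected {n} H = ∀ (u w : Fin n) → ∃[ d ] (dist H u w ≡ just d)

_+∞_ : Maybe ℕ → Maybe ℕ → Maybe ℕ
just a +∞ just b = just (a + b)
_      +∞ _      = nothing

_⊔∞_ : Maybe ℕ → Maybe ℕ → Maybe ℕ
just a ⊔∞ just b = just (a ⊔ b)
_      ⊔∞ _      = nothing

verts : ∀ n → List (Fin n)
verts n = allFin n

pairs : ∀ n → List (Fin n × Fin n)
pairs n = concatMap (λ u → map (λ w → (u , w)) (filter (λ w → toℕ u <? toℕ w) (allFin n))) (allFin n)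

diameter : ∀ {n} → Hypergraph n → Maybe ℕ
diameter {n} H = foldr (λ p acc → dist H (proj₁ p) (proj₂ p) ⊔∞ acc) (just 0)
                   (cartesianProduct (allFin n) (allFin n))

wiener : ∀ {n} → Hypergraph n → Maybe ℕ
wiener {n} H = foldr (λ p acc → dist H (proj₁ p) (proj₂ p) +∞ acc) (just 0) (pairs n)

-- In diameter two, distinct vertices are at distance 1 if a hyperedge contains both and at
-- distance 2 otherwise, so W(H) = wiener₂ E: each of the 28 pairs costs 1 if linked by the
-- edge list E and 2 if not. The bound is a branch-and-bound search over partial edge lists
-- F ⊆ E, run by the type checker. Adding edges only links more pairs, so wiener₂ E ≤ wiener₂ F.
-- A vertex that F misses lies in an edge of E linking it to three new vertices, and two such
-- vertices gain at least five new pairs; this prunes F as soon as wiener₂ F is small. Otherwise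
-- a proper vertex set S is chosen; since any vertex of S reaches any vertex outside S in at most
-- two edges, some edge of E crosses S, and the search branches over the 4-sets crossing S. The
-- only leaves that do not give wiener₂ E ≤ 40 are three edges F linking 15 pairs such that every
-- 4-set all of whose pairs F links belongs to F; if wiener₂ E = 41 then E links no new pair, so
-- every edge of E is in F and E has exactly three edges.

module Submission where

open import Defs
open import Data.Bool using (Bool; true; false; T; not; _∧_; _∨_; if_then_else_)
import Data.Bool.Properties as Bool
open import Data.Bool.Properties using (T-∧; T-∨; T-≡; T?)
open import Data.Bool.ListAction using (any; all)
open import Data.Empty using (⊥-elim)
open import Data.Fin using (Fin; zero; _≟_)
open import Data.Fin.Properties using (punchInᵢ≢i)
open import Data.Fin.Subset using (Subset; ∣_∣; ⁅_⁆; ⊤; _∪_)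
open import Data.List using (List; []; _∷_; _++_; map; foldr; length; allFin; filterᵇ; cartesianProduct)
open import Data.List.Membership.Propositional using (_∈_; lose; find)
open import Data.List.Membership.Propositional.Properties
  using (∈-allFin; ∈-cartesianProduct⁺; ∈-++⁺ˡ; ∈-++⁺ʳ; ∈-map⁺; ∈-filter⁺)
open import Data.List.Membership.Propositional.Properties.WithK using (unique∧set⇒bag)
open import Data.List.Relation.Binary.BagAndSetEquality using (∼bag⇒↭)
open import Data.List.Relation.Binary.Permutation.Propositional.Properties using (↭-length)
open import Data.List.Relation.Binary.Subset.Propositional using (_⊆_)
open import Data.List.Relation.Binary.Subset.Propositional.Properties using (∈-∷⁺ʳ)
open import Data.List.Relation.Unary.All as All using (All; []; _∷_)
open import Data.List.Relation.Unary.All.Properties using (all⁺; all-filter; ++⁺; map⁺)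
open import Data.List.Relation.Unary.AllPairs using ([]; _∷_)
open import Data.List.Relation.Unary.Any using (here; there; satisfied)
open import Data.List.Relation.Unary.Any.Properties using (any⁺; any⁻)
open import Data.List.Relation.Unary.Unique.Propositional using (Unique)
open import Data.List.Relation.Unary.Unique.Propositional.Properties using (allFin⁺; filter⁺)
open import Data.Maybe using (Maybe; just; nothing)
open import Data.Maybe.Properties using (just-injective)
open import Data.Nat using (ℕ; zero; suc; _+_; _≤_; _<_; _≤ᵇ_; _≡ᵇ_; z≤n; s≤s)
open import Data.Nat.ListAction using (sum)
open import Data.Nat.Properties
  using (≤-refl; ≤-trans; ≤-reflexive; ≤⇒≯; n≤1+n; m≤m+n; m≤n⇒m<n∨m≡n; m⊔n≤o⇒m≤o; m⊔n≤o⇒n≤o;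
         +-mono-≤; +-monoʳ-≤; +-assoc; +-identityʳ; +-cancelʳ-≤; +-cancelˡ-≡; m+n≡0⇒m≡0; m+n≡0⇒n≡0;
         ≤ᵇ⇒≤; ≡ᵇ⇒≡; +-commutativeSemigroup; module ≤-Reasoning)
open import Data.Product using (_×_; _,_; proj₁; proj₂; ∃-syntax)
open import Data.Sum using (_⊎_; inj₁; inj₂; [_,_])
open import Data.Unit using (tt)
open import Data.Vec using ([]; _∷_; lookup)
import Data.Vec.Properties as Vec
open import Function using (_∘_; _$_; Equivalence; mk⇔)
open import Relation.Binary.PropositionalEquality
  using (_≡_; _≢_; refl; sym; trans; cong; cong₂; subst; module ≡-Reasoning)
open import Relation.Nullary using (¬_; yes; no)
open import Relation.Nullary.Decidable using (⌊_⌋; toWitness; fromWitness)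

open import Algebra.Properties.CommutativeSemigroup +-commutativeSemigroup using (interchange)
open import Data.List.Relation.Unary.Unique.DecPropositional (Vec.≡-dec {n = 8} Bool._≟_) using (unique?)
open import Data.List.Membership.DecPropositional (Vec.≡-dec {n = 8} Bool._≟_) using (_∈?_)

open Equivalence using (to; from)

private
  variable
    A : Set
    n : ℕ

T-not : ∀ {b} → ¬ T b → T (not b)
T-not {false} _  = tt
T-not {true}  ¬b = ¬b tt

T-not⁻ : ∀ {b} → T (not b) → ¬ T b
T-not⁻ {false} _ ()

_⇒ᵇ_ : Bool → Bool → Bool
a ⇒ᵇ b = not a ∨ b

⇒ᵇ-elim : ∀ {a b} → T (a ⇒ᵇ b) → T a → T b
⇒ᵇ-elim {true} h _ = h

all-∈ : ∀ (p : A → Bool) {xs x} → T (all p xs) → x ∈ xs → T (p x)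
all-∈ p {xs} h = All.lookup (all⁺ p xs h)

orderedPairs : List A → List (A × A)
orderedPairs []       = []
orderedPairs (x ∷ xs) = map (x ,_) xs ++ orderedPairs xs

orderedPairs-≢ : ∀ {xs : List A} → Unique xs → All (λ p → proj₁ p ≢ proj₂ p) (orderedPairs xs)
orderedPairs-≢ []              = []
orderedPairs-≢ (x≢xs ∷ unique) = ++⁺ (map⁺ x≢xs) (orderedPairs-≢ unique)

⊆-⊇-length : ∀ {xs ys : List A} → Unique xs → Unique ys → xs ⊆ ys → ys ⊆ xs →
  length xs ≡ length ys
⊆-⊇-length uxs uys xs⊆ys ys⊆xs =
  ↭-length (∼bag⇒↭ (unique∧set⇒bag uxs uys (mk⇔ xs⊆ys ys⊆xs)))

-- Sums of pair distances

pairDist : Bool → ℕ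
pairDist true  = 1
pairDist false = 2

indicator : Bool → ℕ
indicator true  = 1
indicator false = 0

distanceSum : (A → Bool) → List A → ℕ
distanceSum linkedᵇ xs = sum (map (pairDist ∘ linkedᵇ) xs)

countᵇ : (A → Bool) → List A → ℕ
countᵇ p xs = sum (map (indicator ∘ p) xs)

pairDist-T : ∀ {b} → T b → pairDist b ≡ 1
pairDist-T {true} _ = refl

pairDist-¬T : ∀ {b} → ¬ T b → pairDist b ≡ 2
pairDist-¬T {false} _  = refl
pairDist-¬T {true}  ¬b = ⊥-elim (¬b tt)

pairDist-split : ∀ {b d} → (T b → T d) → pairDist d + indicator (d ∧ not b) ≡ pairDist b
pairDist-split {true}  {true}  _   = refl
pairDist-split {true}  {false} b⇒d = ⊥-elim (b⇒d tt)
pairDist-split {false} {true}  _   = refl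
pairDist-split {false} {false} _   = refl

distanceSum-split : (b d : A → Bool) → (∀ x → T (b x) → T (d x)) → ∀ xs →
  distanceSum d xs + countᵇ (λ x → d x ∧ not (b x)) xs ≡ distanceSum b xs
distanceSum-split b d b⇒d []       = refl
distanceSum-split b d b⇒d (x ∷ xs) = begin
  (pairDist (d x) + distanceSum d xs) + (indicator (d x ∧ not (b x)) + countᵇ new xs)
    ≡⟨ interchange (pairDist (d x)) _ _ _ ⟩
  (pairDist (d x) + indicator (d x ∧ not (b x))) + (distanceSum d xs + countᵇ new xs)
    ≡⟨ cong₂ _+_ (pairDist-split (b⇒d x)) (distanceSum-split b d b⇒d xs) ⟩
  pairDist (b x) + distanceSum b xs ∎
  where
  open ≡-Reasoning
  new = λ x → d x ∧ not (b x)

distanceSum-anti : (b d : A → Bool) → (∀ x → T (b x) → T (d x)) → ∀ xs →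
  distanceSum d xs ≤ distanceSum b xs
distanceSum-anti b d b⇒d xs =
  subst (distanceSum d xs ≤_) (distanceSum-split b d b⇒d xs) (m≤m+n _ _)

indicator-mono : ∀ {a b} → (T a → T b) → indicator a ≤ indicator b
indicator-mono {false}         _   = z≤n
indicator-mono {true}  {true}  _   = ≤-refl
indicator-mono {true}  {false} a⇒b = ⊥-elim (a⇒b tt)

countᵇ-mono : (p q : A → Bool) → (∀ x → T (p x) → T (q x)) → ∀ xs → countᵇ p xs ≤ countᵇ q xs
countᵇ-mono p q p⇒q []       = z≤n
countᵇ-mono p q p⇒q (x ∷ xs) = +-mono-≤ (indicator-mono (p⇒q x)) (countᵇ-mono p q p⇒q xs)

indicator≡0 : ∀ {b} → indicator b ≡ 0 → ¬ T b
indicator≡0 {false} _ ()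

countᵇ≡0 : (p : A → Bool) → ∀ {xs x} → countᵇ p xs ≡ 0 → x ∈ xs → ¬ T (p x)
countᵇ≡0 p {y ∷ _} c≡0 (here refl) = indicator≡0 (m+n≡0⇒m≡0 (indicator (p y)) c≡0)
countᵇ≡0 p {y ∷ _} c≡0 (there x∈) = countᵇ≡0 p (m+n≡0⇒n≡0 (indicator (p y)) c≡0) x∈

-- Distances in a hypergraph of diameter two

AtMost : ℕ → Maybe ℕ → Set
AtMost D a = ∃[ d ] a ≡ just d × d ≤ D

⊔∞-atMost : ∀ {D} a b → AtMost D (a ⊔∞ b) → AtMost D a × AtMost D b
⊔∞-atMost (just x) (just y) (_ , refl , x⊔y≤D) =
  (x , refl , m⊔n≤o⇒m≤o x y x⊔y≤D) , (y , refl , m⊔n≤o⇒n≤o x y x⊔y≤D)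
⊔∞-atMost nothing  _        (_ , () , _)
⊔∞-atMost (just _) nothing  (_ , () , _)

foldr-⊔∞-atMost : ∀ {D} (f : A → Maybe ℕ) xs →
  AtMost D (foldr (λ x acc → f x ⊔∞ acc) (just 0) xs) → All (AtMost D ∘ f) xs
foldr-⊔∞-atMost f []       _ = []
foldr-⊔∞-atMost f (x ∷ xs) h =
  let fx , rest = ⊔∞-atMost (f x) _ h in fx ∷ foldr-⊔∞-atMost f xs rest

if-just : ∀ b {ℓ d} {r : Maybe ℕ} → (if b then just ℓ else r) ≡ just d →
  (T b × ℓ ≡ d) ⊎ (¬ T b × r ≡ just d)
if-just true  refl = inj₁ (tt , refl)
if-just false h    = inj₂ ((λ ()) , h)

module _ (H : Hypergraph n) where

  walk-zero⁻ : ∀ {u w} → T (walk H 0 u w) → u ≡ w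
  walk-zero⁻ {u} {w} = toWitness {a? = u ≟ w}

  walk-suc⁻ : ∀ {ℓ u w} → T (walk H (suc ℓ) u w) → ∃[ x ] T (adj H u x) × T (walk H ℓ x w)
  walk-suc⁻ {ℓ} {u} {w} h =
    let x , step = satisfied (any⁻ (λ x → adj H u x ∧ walk H ℓ x w) (allFin n) h)
    in x , to T-∧ step

  walk-one⁻ : ∀ {u w} → T (walk H 1 u w) → T (adj H u w)
  walk-one⁻ {u} {w} h with walk-suc⁻ {0} {u} {w} h
  ... | x , ux , x≡w = subst (T ∘ adj H u) (walk-zero⁻ {x} {w} x≡w) ux

  walk-one⁺ : ∀ {u w} → T (adj H u w) → T (walk H 1 u w)
  walk-one⁺ {u} {w} uw =
    any⁺ (λ x → adj H u x ∧ walk H 0 x w) (lose (∈-allFin w) (from T-∧ (uw , fromWitness refl)))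

  search-least : ∀ {u w d} ℓ k → search H u w ℓ k ≡ just d →
    T (walk H d u w) × (∀ {m} → ℓ ≤ m → m < d → ¬ T (walk H m u w))
  search-least {u} {w} ℓ zero h with if-just (walk H ℓ u w) h
  ... | inj₁ (walk-ℓ , refl) = walk-ℓ , λ ℓ≤m m<ℓ _ → ≤⇒≯ ℓ≤m m<ℓ
  ... | inj₂ (_ , ())
  search-least {u} {w} ℓ (suc k) h with if-just (walk H ℓ u w) h
  ... | inj₁ (walk-ℓ , refl) = walk-ℓ , λ ℓ≤m m<ℓ _ → ≤⇒≯ ℓ≤m m<ℓ
  ... | inj₂ (¬walk-ℓ , h′) =
    let walk-d , none-below = search-least (suc ℓ) k h′
    in walk-d , λ ℓ≤m m<d → [ (λ ℓ<m → none-below ℓ<m m<d) , (λ { refl → ¬walk-ℓ }) ]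
                            (m≤n⇒m<n∨m≡n ℓ≤m)

  dist-least : ∀ {u w d} → dist H u w ≡ just d →
    T (walk H d u w) × (∀ {m} → m < d → ¬ T (walk H m u w))
  dist-least h = let walk-d , none-below = search-least 0 n h in walk-d , none-below z≤n

  dist-within-two : ∀ {u w d} → u ≢ w → dist H u w ≡ just d → d ≤ 2 → d ≡ pairDist (adj H u w)
  dist-within-two {d = 0} u≢w h _ = ⊥-elim (u≢w (walk-zero⁻ (proj₁ (dist-least h))))
  dist-within-two {d = 1} u≢w h _ = sym (pairDist-T (walk-one⁻ (proj₁ (dist-least h))))
  dist-within-two {d = 2} u≢w h _ =
    sym (pairDist-¬T (proj₂ (dist-least h) (s≤s (s≤s z≤n)) ∘ walk-one⁺))
  dist-within-two {d = suc (suc (suc _))} _ _ (s≤s (s≤s ()))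

  module _ (diam : diameter H ≡ just 2) where

    dist-atMost-two : ∀ u w → AtMost 2 (dist H u w)
    dist-atMost-two u w =
      All.lookup (foldr-⊔∞-atMost (λ p → dist H (proj₁ p) (proj₂ p))
                                  (cartesianProduct (allFin n) (allFin n)) (2 , diam , ≤-refl))
                 (∈-cartesianProduct⁺ (∈-allFin u) (∈-allFin w))

    dist-diameter-two : ∀ {u w} → u ≢ w → dist H u w ≡ just (pairDist (adj H u w))
    dist-diameter-two {u} {w} u≢w =
      let d , h , d≤2 = dist-atMost-two u w in trans h (cong just (dist-within-two u≢w h d≤2))

    adj-or-common-neighbour : ∀ {u w} → u ≢ w →
      T (adj H u w) ⊎ ∃[ x ] T (adj H u x) × T (adj H x w)
    adj-or-common-neighbour {u} {w} u≢w with T? (adj H u w)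
    ... | yes uw = inj₁ uw
    ... | no ¬uw =
      let d , h , d≤2 = dist-atMost-two u w
          d≡2         = trans (dist-within-two u≢w h d≤2) (pairDist-¬T ¬uw)
          walk-2      = subst (λ d → T (walk H d u w)) d≡2 (proj₁ (dist-least h))
          x , ux , xw = walk-suc⁻ {1} {u} {w} walk-2
      in inj₂ (x , ux , walk-one⁻ {x} {w} xw)

    wiener-distanceSum : ∀ ps → All (λ p → proj₁ p ≢ proj₂ p) ps →
      foldr (λ p acc → dist H (proj₁ p) (proj₂ p) +∞ acc) (just 0) ps
        ≡ just (distanceSum (λ p → adj H (proj₁ p) (proj₂ p)) ps)
    wiener-distanceSum []       []          = refl
    wiener-distanceSum (p ∷ ps) (u≢w ∷ ≢s)
      rewrite dist-diameter-two u≢w | wiener-distanceSum ps ≢s = refl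

-- Pairs linked by a list of edges

contains : Subset n → Fin n × Fin n → Bool
contains e p = lookup e (proj₁ p) ∧ lookup e (proj₂ p)

linked : List (Subset n) → Fin n × Fin n → Bool
linked E p = any (λ e → contains e p) E

vertexPairs : (n : ℕ) → List (Fin n × Fin n)
vertexPairs n = orderedPairs (allFin n)

wiener₂ : List (Subset n) → ℕ
wiener₂ {n} E = distanceSum (linked E) (vertexPairs n)

-- pairs 8 and vertexPairs 8 evaluate to the same list, which is what makes this typecheck.
wiener-diameter-two : (H : Hypergraph 8) → diameter H ≡ just 2 → wiener H ≡ just (wiener₂ (edges H))
wiener-diameter-two H diam = wiener-distanceSum H diam (vertexPairs 8) (orderedPairs-≢ (allFin⁺ 8))

linked⁺ : ∀ {E : List (Subset n)} {e p} → e ∈ E → T (contains e p) → T (linked E p)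
linked⁺ e∈E ep = any⁺ _ (lose e∈E ep)

linked⁻ : ∀ {E : List (Subset n)} {u w} → T (linked E (u , w)) →
  ∃[ e ] e ∈ E × T (lookup e u) × T (lookup e w)
linked⁻ {E = E} uw = let e , e∈E , euw = find (any⁻ _ E uw) in e , e∈E , to T-∧ euw

linked-mono : ∀ {E F : List (Subset n)} {p} → F ⊆ E → T (linked F p) → T (linked E p)
linked-mono {F = F} F⊆E l =
  let e , e∈F , eu , ew = linked⁻ {E = F} l in linked⁺ (F⊆E e∈F) (from T-∧ (eu , ew))

wiener₂-anti : ∀ {E F : List (Subset n)} → F ⊆ E → wiener₂ E ≤ wiener₂ F
wiener₂-anti {n} {E} {F} F⊆E =
  distanceSum-anti (linked F) (linked E) (λ _ → linked-mono F⊆E) (vertexPairs n)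

wiener₂-≡⇒linked : ∀ {E F : List (Subset n)} {p} → F ⊆ E → wiener₂ E ≡ wiener₂ F →
  p ∈ vertexPairs n → T (linked E p) → T (linked F p)
wiener₂-≡⇒linked {n} {E} {F} {p} F⊆E same p∈ l with T? (linked F p)
... | yes lF = lF
... | no ¬lF = ⊥-elim (countᵇ≡0 new no-new p∈ (from T-∧ (l , T-not ¬lF)))
  where
  new = λ p → linked E p ∧ not (linked F p)
  no-new : countᵇ new (vertexPairs n) ≡ 0
  no-new = +-cancelˡ-≡ (wiener₂ E) _ 0 $ begin
    wiener₂ E + countᵇ new (vertexPairs n)
      ≡⟨ distanceSum-split (linked F) (linked E) (λ _ → linked-mono F⊆E) (vertexPairs n) ⟩
    wiener₂ F
      ≡⟨ sym same ⟩
    wiener₂ E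
      ≡⟨ +-identityʳ _ ⟨
    wiener₂ E + 0 ∎
    where open ≡-Reasoning

wiener₂-step : ∀ (F : List (Subset n)) e (t : Fin n × Fin n → Bool) →
  (∀ p → T (linked F p) → ¬ T (t p)) →
  wiener₂ (e ∷ F) + countᵇ (λ p → contains e p ∧ t p) (vertexPairs n) ≤ wiener₂ F
wiener₂-step {n} F e t untouched = begin
  wiener₂ (e ∷ F) + countᵇ (λ p → contains e p ∧ t p) (vertexPairs n)
    ≤⟨ +-monoʳ-≤ (wiener₂ (e ∷ F)) (countᵇ-mono _ _ new-link (vertexPairs n)) ⟩
  wiener₂ (e ∷ F) + countᵇ (λ p → linked (e ∷ F) p ∧ not (linked F p)) (vertexPairs n)
    ≡⟨ distanceSum-split (linked F) (linked (e ∷ F)) (λ p → from T-∨ ∘ inj₂) (vertexPairs n) ⟩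
  wiener₂ F ∎
  where
  open ≤-Reasoning
  new-link : ∀ p → T (contains e p ∧ t p) → T (linked (e ∷ F) p ∧ not (linked F p))
  new-link p et = let ep , tp = to T-∧ et in
    from T-∧ (from T-∨ (inj₁ ep) , T-not (λ lF → untouched p lF tp))

-- Subsets, coverage and crossing

subsetsOfSize : ℕ → (n : ℕ) → List (Subset n)
subsetsOfSize zero    zero    = [] ∷ []
subsetsOfSize (suc k) zero    = []
subsetsOfSize zero    (suc n) = map (false ∷_) (subsetsOfSize zero n)
subsetsOfSize (suc k) (suc n) =
  map (true ∷_) (subsetsOfSize k n) ++ map (false ∷_) (subsetsOfSize (suc k) n)

∈-subsetsOfSize : (s : Subset n) → s ∈ subsetsOfSize ∣ s ∣ n
∈-subsetsOfSize []          = here refl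
∈-subsetsOfSize (true ∷ s)  = ∈-++⁺ˡ (∈-map⁺ (true ∷_) (∈-subsetsOfSize s))
∈-subsetsOfSize (false ∷ s) with ∣ s ∣ | ∈-subsetsOfSize s
... | zero  | s∈ = ∈-map⁺ (false ∷_) s∈
... | suc k | s∈ = ∈-++⁺ʳ (map (true ∷_) (subsetsOfSize k _)) (∈-map⁺ (false ∷_) s∈)

covered : List (Subset n) → Fin n → Bool
covered F u = any (λ e → lookup e u) F

uncovered : List (Subset n) → List (Fin n)
uncovered F = filterᵇ (not ∘ covered F) (allFin _)

touches : Fin n → Fin n × Fin n → Bool
touches u p = ⌊ proj₁ p ≟ u ⌋ ∨ ⌊ proj₂ p ≟ u ⌋

uncovered-untouched : ∀ (F : List (Subset n)) {u} p → ¬ T (covered F u) → T (linked F p) →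
  ¬ T (touches u p)
uncovered-untouched F {u} (x , y) u∉F l touch with linked⁻ {E = F} l
... | e , e∈F , ex , ey = u∉F (any⁺ _ (lose e∈F ([ at ex , at ey ] (to (T-∨ {⌊ x ≟ u ⌋}) touch))))
  where
  at : ∀ {v} → T (lookup e v) → T ⌊ v ≟ u ⌋ → T (lookup e u)
  at {v} ev v≡u = subst (T ∘ lookup e) (toWitness {a? = v ≟ u} v≡u) ev

crosses : Subset n → Subset n → Bool
crosses S s = any (λ u → lookup s u ∧ lookup S u) (allFin _)
            ∧ any (λ u → lookup s u ∧ not (lookup S u)) (allFin _)

crosses⁺ : ∀ (S s : Subset n) {u w} → T (lookup s u) → T (lookup S u) →
  T (lookup s w) → ¬ T (lookup S w) → T (crosses S s)
crosses⁺ S s {u} {w} su Su sw ¬Sw =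
  from T-∧ ( any⁺ _ (lose (∈-allFin u) (from T-∧ (su , Su)))
           , any⁺ _ (lose (∈-allFin w) (from T-∧ (sw , T-not ¬Sw))))

linked-crosses : ∀ {E : List (Subset n)} S {u w} → T (linked E (u , w)) →
  T (lookup S u) → ¬ T (lookup S w) → ∃[ e ] e ∈ E × T (crosses S e)
linked-crosses {E = E} S uw Su ¬Sw =
  let e , e∈E , eu , ew = linked⁻ {E = E} uw in e , e∈E , crosses⁺ S e eu Su ew ¬Sw

proper : Subset n → Bool
proper S = crosses S ⊤

proper⁻ : ∀ {S : Subset n} → T (proper S) → (∃[ u ] T (lookup S u)) × (∃[ w ] ¬ T (lookup S w))
proper⁻ {S = S} h =
  let inside , outside = to T-∧ h
      u , ⊤u∧Su  = satisfied (any⁻ _ (allFin _) inside)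
      w , ⊤w∧¬Sw = satisfied (any⁻ _ (allFin _) outside)
  in (u , proj₂ (to T-∧ ⊤u∧Su)) , (w , T-not⁻ (proj₂ (to T-∧ ⊤w∧¬Sw)))

quadruples : List (Subset 8)
quadruples = subsetsOfSize 4 8

quadruple-∈ : ∀ {e : Subset 8} → ∣ e ∣ ≡ 4 → e ∈ quadruples
quadruple-∈ {e} ∣e∣≡4 = subst (λ k → e ∈ subsetsOfSize k 8) ∣e∣≡4 (∈-subsetsOfSize e)

quadruple-touches-one : ∀ {c u} → c ∈ quadruples → T (lookup c u) →
  3 ≤ countᵇ (λ p → contains c p ∧ touches u p) (vertexPairs 8)
quadruple-touches-one {c} {u} c∈ cu =
  ≤ᵇ⇒≤ 3 _ (⇒ᵇ-elim (all-∈ (claim c) (all-∈ claims checked c∈) (∈-allFin u)) cu)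
  where
  claim : Subset 8 → Fin 8 → Bool
  claim c u = lookup c u ⇒ᵇ (3 ≤ᵇ countᵇ (λ p → contains c p ∧ touches u p) (vertexPairs 8))
  claims : Subset 8 → Bool
  claims c = all (claim c) (allFin 8)
  checked : T (all claims quadruples)
  checked = tt

quadruple-touches-two : ∀ {c u v} → c ∈ quadruples → u ≢ v → T (lookup c u) → T (lookup c v) →
  5 ≤ countᵇ (λ p → contains c p ∧ (touches u p ∨ touches v p)) (vertexPairs 8)
quadruple-touches-two {c} {u} {v} c∈ u≢v cu cv =
  ≤ᵇ⇒≤ 5 _ (⇒ᵇ-elim (all-∈ (claim c u) claims-u (∈-allFin v))
                    (from T-∧ (cu , from T-∧ (cv , T-not (u≢v ∘ toWitness {a? = u ≟ v})))))
  where
  claim : Subset 8 → Fin 8 → Fin 8 → Bool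
  claim c u v = (lookup c u ∧ lookup c v ∧ not ⌊ u ≟ v ⌋) ⇒ᵇ
                (5 ≤ᵇ countᵇ (λ p → contains c p ∧ (touches u p ∨ touches v p)) (vertexPairs 8))
  claims : Subset 8 → Bool
  claims c = all (λ u → all (claim c u) (allFin 8)) (allFin 8)
  checked : T (all claims quadruples)
  checked = tt
  claims-u : T (all (claim c u) (allFin 8))
  claims-u = all-∈ (λ u → all (claim c u) (allFin 8)) (all-∈ claims checked c∈) (∈-allFin u)

-- The branch-and-bound search

coverGain : List A → ℕ
coverGain []          = 0
coverGain (_ ∷ [])    = 3
coverGain (_ ∷ _ ∷ _) = 5

prunable : List (Subset 8) → Bool
prunable F = wiener₂ F ≤ᵇ 40 + coverGain (uncovered F)

hasUnlinkedPair : List (Subset 8) → Subset 8 → Bool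
hasUnlinkedPair F c = any (λ p → contains c p ∧ not (linked F p)) (vertexPairs 8)

closed : List (Subset 8) → Bool
closed F = all (λ c → hasUnlinkedPair F c ∨ ⌊ c ∈? F ⌋) quadruples

extremal : List (Subset 8) → Bool
extremal F = (wiener₂ F ≡ᵇ 41) ∧ (length F ≡ᵇ 3) ∧ ⌊ unique? F ⌋ ∧ closed F

grow : List (Subset n) → Subset n → Subset n
grow F S = foldr (λ e S′ → if any (λ u → lookup e u ∧ lookup S u) (allFin _) then e ∪ S′ else S′) S F

-- Soundness only needs cut F to be a proper nonempty subset; taking an uncovered vertex,
-- or else the component of vertex 0 in F, keeps the search small.
cut : List (Subset 8) → Subset 8
cut F with uncovered F
... | u ∷ _ = ⁅ u ⁆
... | []    = grow F (grow F (grow F (grow F (grow F ⁅ zero ⁆))))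

settled : ℕ → List (Subset 8) → Bool
settled zero    F = false
settled (suc k) F = prunable F ∨ extremal F ∨
  (proper (cut F) ∧ all (λ c → settled k (c ∷ F)) (filterᵇ (crosses (cut F)) quadruples))

extremal⁻ : ∀ {F} → T (extremal F) → wiener₂ F ≡ 41 × length F ≡ 3 × Unique F × T (closed F)
extremal⁻ {F} h =
  let wiener-F , rest     = to (T-∧ {wiener₂ F ≡ᵇ 41}) h
      length-F , rest′    = to (T-∧ {length F ≡ᵇ 3}) rest
      unique-F , closed-F = to (T-∧ {⌊ unique? F ⌋}) rest′
  in ≡ᵇ⇒≡ _ 41 wiener-F , ≡ᵇ⇒≡ _ 3 length-F , toWitness {a? = unique? F} unique-F , closed-F

closed-sound : ∀ {F c} → T (closed F) → c ∈ quadruples →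
  (∀ {p} → p ∈ vertexPairs 8 → T (contains c p) → T (linked F p)) → c ∈ F
closed-sound {F} {c} h c∈ spanned =
  [ ⊥-elim ∘ no-gap , toWitness {a? = c ∈? F} ]
  (to (T-∨ {hasUnlinkedPair F c}) (all-∈ (λ c → hasUnlinkedPair F c ∨ ⌊ c ∈? F ⌋) h c∈))
  where
  no-gap : ¬ T (hasUnlinkedPair F c)
  no-gap gap =
    let p , p∈ , cp∧¬Fp = find (any⁻ (λ p → contains c p ∧ not (linked F p)) (vertexPairs 8) gap)
        cp , ¬Fp        = to (T-∧ {contains c p}) cp∧¬Fp
    in T-not⁻ ¬Fp (spanned p∈ cp)

WienerBound : List (Subset n) → Set
WienerBound E = wiener₂ E ≤ 41 × (wiener₂ E ≡ 41 → length E ≡ 3)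

module Search
  (E : List (Subset 8))
  (quadruple : ∀ {e} → e ∈ E → e ∈ quadruples)
  (within-two : ∀ {u w} → u ≢ w →
    T (linked E (u , w)) ⊎ ∃[ x ] T (linked E (u , x)) × T (linked E (x , w)))
  (unique : Unique E)
  where

  covering-edge : ∀ u → ∃[ e ] e ∈ E × T (lookup e u)
  covering-edge u with within-two (punchInᵢ≢i u zero ∘ sym)
  ... | inj₁ uw           = let e , e∈E , eu , _ = linked⁻ {E = E} uw in e , e∈E , eu
  ... | inj₂ (x , ux , _) = let e , e∈E , eu , _ = linked⁻ {E = E} ux in e , e∈E , eu

  crossing-edge : ∀ S {u w} → T (lookup S u) → ¬ T (lookup S w) → ∃[ e ] e ∈ E × T (crosses S e)
  crossing-edge S {u} {w} Su ¬Sw with within-two {u} {w} (λ { refl → ¬Sw Su })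
  ... | inj₁ uw = linked-crosses S uw Su ¬Sw
  ... | inj₂ (x , ux , xw) with T? (lookup S x)
  ...   | yes Sx = linked-crosses S xw Sx ¬Sw
  ...   | no ¬Sx = linked-crosses S ux Su ¬Sx

  uncovered-gain-one : ∀ {F u} → F ⊆ E → ¬ T (covered F u) → wiener₂ E + 3 ≤ wiener₂ F
  uncovered-gain-one {F} {u} F⊆E u∉F =
    let e , e∈E , eu = covering-edge u in begin
    wiener₂ E + 3
      ≤⟨ +-mono-≤ (wiener₂-anti (∈-∷⁺ʳ e∈E F⊆E)) (quadruple-touches-one (quadruple e∈E) eu) ⟩
    wiener₂ (e ∷ F) + countᵇ (λ p → contains e p ∧ touches u p) (vertexPairs 8)
      ≤⟨ wiener₂-step F e (touches u) (λ p → uncovered-untouched F p u∉F) ⟩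
    wiener₂ F ∎
    where open ≤-Reasoning

  uncovered-gain-two : ∀ {F u v} → F ⊆ E → u ≢ v → ¬ T (covered F u) → ¬ T (covered F v) →
    wiener₂ E + 5 ≤ wiener₂ F
  uncovered-gain-two {F} {u} {v} F⊆E u≢v u∉F v∉F with covering-edge u
  ... | e , e∈E , eu with T? (lookup e v)
  ...   | yes ev = begin
    wiener₂ E + 5
      ≤⟨ +-mono-≤ (wiener₂-anti (∈-∷⁺ʳ e∈E F⊆E)) (quadruple-touches-two (quadruple e∈E) u≢v eu ev) ⟩
    wiener₂ (e ∷ F) + countᵇ (λ p → contains e p ∧ (touches u p ∨ touches v p)) (vertexPairs 8)
      ≤⟨ wiener₂-step F e (λ p → touches u p ∨ touches v p) untouched ⟩
    wiener₂ F ∎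
    where
    open ≤-Reasoning
    untouched : ∀ p → T (linked F p) → ¬ T (touches u p ∨ touches v p)
    untouched p l = [ uncovered-untouched F p u∉F l , uncovered-untouched F p v∉F l ]
                  ∘ to (T-∨ {touches u p})
  ...   | no ¬ev = begin
    wiener₂ E + 5
      ≤⟨ +-monoʳ-≤ (wiener₂ E) (n≤1+n 5) ⟩
    wiener₂ E + (3 + 3)
      ≡⟨ +-assoc (wiener₂ E) 3 3 ⟨
    wiener₂ E + 3 + 3
      ≤⟨ +-mono-≤ (uncovered-gain-one (∈-∷⁺ʳ e∈E F⊆E) v∉e∷F) (quadruple-touches-one (quadruple e∈E) eu) ⟩
    wiener₂ (e ∷ F) + countᵇ (λ p → contains e p ∧ touches u p) (vertexPairs 8)
      ≤⟨ wiener₂-step F e (touches u) (λ p → uncovered-untouched F p u∉F) ⟩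
    wiener₂ F ∎
    where
    open ≤-Reasoning
    v∉e∷F : ¬ T (covered (e ∷ F) v)
    v∉e∷F = [ ¬ev , v∉F ] ∘ to (T-∨ {lookup e v})

  coverGain-bound : ∀ {F} → F ⊆ E → (us : List (Fin 8)) → Unique us →
    All (λ u → T (not (covered F u))) us → wiener₂ E + coverGain us ≤ wiener₂ F
  coverGain-bound F⊆E []          _               _               =
    ≤-trans (≤-reflexive (+-identityʳ _)) (wiener₂-anti F⊆E)
  coverGain-bound F⊆E (u ∷ [])    _               (u∉F ∷ _)       =
    uncovered-gain-one F⊆E (T-not⁻ u∉F)
  coverGain-bound F⊆E (u ∷ v ∷ _) ((u≢v ∷ _) ∷ _) (u∉F ∷ v∉F ∷ _) =
    uncovered-gain-two F⊆E u≢v (T-not⁻ u∉F) (T-not⁻ v∉F)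

  prunable-sound : ∀ {F} → F ⊆ E → T (prunable F) → wiener₂ E ≤ 40
  prunable-sound {F} F⊆E h = +-cancelʳ-≤ (coverGain (uncovered F)) (wiener₂ E) 40 $ begin
    wiener₂ E + coverGain (uncovered F)
      ≤⟨ coverGain-bound F⊆E (uncovered F) (filter⁺ uncovered? (allFin⁺ 8)) (all-filter uncovered? (allFin 8)) ⟩
    wiener₂ F
      ≤⟨ ≤ᵇ⇒≤ (wiener₂ F) _ h ⟩
    40 + coverGain (uncovered F) ∎
    where
    open ≤-Reasoning
    uncovered? = T? ∘ (not ∘ covered F)

  closed-extremal : ∀ {F} → F ⊆ E → wiener₂ F ≡ 41 × length F ≡ 3 × Unique F × T (closed F) →
    WienerBound E
  closed-extremal {F} F⊆E (wiener-F , length-F , unique-F , closed-F) =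
    subst (wiener₂ E ≤_) wiener-F (wiener₂-anti F⊆E) ,
    λ wiener-E → trans (⊆-⊇-length unique unique-F (E⊆F wiener-E) F⊆E) length-F
    where
    E⊆F : wiener₂ E ≡ 41 → E ⊆ F
    E⊆F wiener-E e∈E = closed-sound closed-F (quadruple e∈E)
      (λ p∈ ep → wiener₂-≡⇒linked F⊆E (trans wiener-E (sym wiener-F)) p∈ (linked⁺ e∈E ep))

  below-41 : wiener₂ E ≤ 40 → WienerBound E
  below-41 ≤40 = ≤-trans ≤40 (n≤1+n 40) , λ ≡41 → ⊥-elim (≤⇒≯ ≤40 (≤-reflexive (sym ≡41)))

  settled-sound : ∀ k F → F ⊆ E → settled k F ≡ true → WienerBound E
  settled-sound zero    F F⊆E ()
  settled-sound (suc k) F F⊆E h =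
    [ below-41 ∘ prunable-sound F⊆E
    , [ closed-extremal F⊆E ∘ extremal⁻ , branch ] ∘ to (T-∨ {extremal F})
    ] (to (T-∨ {prunable F}) (from T-≡ h))
    where
    S = cut F
    branch : T (proper S ∧ all (λ c → settled k (c ∷ F)) (filterᵇ (crosses S) quadruples)) →
      WienerBound E
    branch h′ =
      let S-proper , children  = to (T-∧ {proper S}) h′
          (u , Su) , (w , ¬Sw) = proper⁻ {S = S} S-proper
          e , e∈E , crosses-e  = crossing-edge S Su ¬Sw
          e-child              = ∈-filter⁺ (T? ∘ crosses S) (quadruple e∈E) crosses-e
      in settled-sound k (e ∷ F) (∈-∷⁺ʳ e∈E F⊆E) (to T-≡ (all-∈ (λ c → settled k (c ∷ F)) children e-child))

-- It is stated with _≡_ rather than T: Agda reduces the type of a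
-- term of type T b to see whether it is the unit type, which would rerun the search at
-- every use of settled-7.
settled-7 : settled 7 [] ≡ true
settled-7 = refl

mainTheorem10 : (H : Hypergraph 8) → Uniform4 H → Connected H →
    diameter H ≡ just 2 → (w : ℕ) → wiener H ≡ just w →
    (w ≤ 41) × (w ≡ 41 → length (edges H) ≡ 3)
mainTheorem10 H uniform _ diam w wiener≡w =
  subst (λ x → x ≤ 41 × (x ≡ 41 → length (edges H) ≡ 3)) (sym w≡wiener₂) bound
  where
  w≡wiener₂ : w ≡ wiener₂ (edges H)
  w≡wiener₂ = just-injective (trans (sym wiener≡w) (wiener-diameter-two H diam))
  bound : WienerBound (edges H)
  bound = Search.settled-sound (edges H) (quadruple-∈ ∘ All.lookup uniform)
                               (adj-or-common-neighbour H diam) (distinct H) 7 [] (λ ()) settled-7
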